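{- Let $r$ and $b$ be positive integers. Then: (i) $v\mapsto \lfloor vr/2^b\rfloor$ is a most uniform map from $[2^b]$ to $[r]$; (ii) $v\mapsto \lfloor vr/2^b\rfloor$ is a most uniform map from $\{1,\ldots,2^b-1\}$ to $[r]$; (iii) $v\mapsto \lfloor (v+1)r/2^b\rfloor$ is a most uniform map from $[2^b-1]$ to $[r]$.
   Context: $[m]=\{0,\ldots,m-1\}$. For a finite set $Q$ with $q=|Q|$, a map $\mu:Q\to[r]$ is most uniform if for every $t\in[r]$ the number of elements of $Q$ mapped to $t$ is either $\lfloor q/r\rfloor$ or $\lceil q/r\rceil$. -}

module Defs where

open import Data.Nat using (ℕ; suc; _+_; _*_; _∸_; _^_; _<_; NonZero; nonZero)
open import Data.Nat.Properties using (_≟_; m^n≢0)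
open import Data.Nat.DivMod using (_/_)
open import Data.List using (List; length; filter; upTo; map)
open import Data.List.Membership.Propositional using (_∈_)
open import Data.List.Relation.Unary.Unique.Propositional using (Unique)
open import Data.Product using (_×_)
open import Data.Sum using (_⊎_)
open import Relation.Binary.PropositionalEquality using (_≡_)

⌈_/_⌉ : (q r : ℕ) → .{{NonZero r}} → ℕ
⌈ q / r ⌉ = (q + r ∸ 1) / r

preimageCount : (ℕ → ℕ) → List ℕ → ℕ → ℕ
preimageCount μ Q t = length (filter (λ v → μ v ≟ t) Q)

-- μ restricted to the finite set Q (a duplicate-free list) is a map Q → [r]
-- and is most uniform: every t ∈ [r] has ⌊q/r⌋ or ⌈q/r⌉ preimages, q = |Q|.
MostUniform : (Q : List ℕ) (r : ℕ) .{{_ : NonZero r}} → (ℕ → ℕ) → Set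
MostUniform Q r μ =
  Unique Q
  × (∀ v → v ∈ Q → μ v < r)
  × (∀ t → t < r →
       (preimageCount μ Q t ≡ length Q / r)
       ⊎ (preimageCount μ Q t ≡ ⌈ length Q / r ⌉))

[_] : ℕ → List ℕ
[ m ] = upTo m

range1 : ℕ → List ℕ
range1 m = map suc (upTo (m ∸ 1))

_/2^_ : ℕ → ℕ → ℕ
x /2^ b = _/_ x (2 ^ b) {{m^n≢0 2 b}}

-- The preimage of t under v ↦ ⌊vr/N⌋ is the interval [⌈tN/r⌉, ⌈(t+1)N/r⌉),
-- so its size is a difference of consecutive ceilings, which lies between
-- ⌊N/r⌋ and ⌈N/r⌉ by super- and subadditivity of the ceiling.  Dropping v = 0
-- shrinks the fibre of 0 from ⌈N/r⌉ to ⌊(N−1)/r⌋; for 0 < t < r the fibre of t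
-- has at most ⌈(N−1)/r⌉ elements because r cannot divide both N − 1 and tN.
-- Part (iii) is part (ii) reindexed by v ↦ v + 1.  The argument works for any
-- N ≥ 1 in place of 2^b.
module Submission where

open import Defs
open import Data.Empty using (⊥; ⊥-elim)
open import Data.Nat using (ℕ; zero; suc; _+_; _*_; _∸_; _^_; _⊓_; _≤_; _<_; NonZero; >-nonZero⁻¹; z≤n; s≤s; s≤s⁻¹)
open import Data.Nat.Properties
open import Data.Nat.DivMod
open import Data.Nat.Divisibility using (_∣_; _∣?_; divides; ∣-refl; n∣m*n; ∣n⇒∣m*n; ∣m+n∣m⇒∣n; ∣⇒≤)
open import Data.Product using (_×_; _,_; proj₁)
open import Data.Product.Function.NonDependent.Propositional using (_×-⇔_)
open import Data.Sum using (_⊎_; inj₁; inj₂)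
open import Data.List using ([]; _∷_; _++_; _∷ʳ_; length; filter; upTo; map)
open import Data.List.Properties using (length-upTo; upTo-∷ʳ; map-upTo; length-++; filter-++; length-map; filter-accept; filter-reject)
open import Data.List.Membership.Propositional using (_∈_)
open import Data.List.Membership.Propositional.Properties using (∈-upTo⁻; ∈-map⁺)
open import Data.List.Relation.Unary.Any using (there)
open import Data.List.Relation.Unary.Unique.Propositional using (Unique)
open import Data.List.Relation.Unary.Unique.Propositional.Properties using (upTo⁺; map⁺; map⁻)
open import Function using (_∘_; _⇔_; mk⇔; Equivalence)
open import Function.Properties.Equivalence using (⇔-setoid)
open import Level using (0ℓ)
open import Relation.Nullary using (¬_; yes; no)
open import Relation.Unary using (Pred; Decidable)
open import Relation.Binary.PropositionalEquality hiding ([_])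
import Relation.Binary.Reasoning.Setoid as SetoidReasoning

open Equivalence using (to; from)

m≡n⇔n≤m<1+n : ∀ {m n} → m ≡ n ⇔ (n ≤ m × m < suc n)
m≡n⇔n≤m<1+n = mk⇔ (λ { refl → ≤-refl , ≤-refl })
                   (λ (n≤m , m<1+n) → ≤-antisym (s≤s⁻¹ m<1+n) n≤m)

m≤o≤n≤1+m⇒o≡m⊎o≡n : ∀ {m n o} → m ≤ o → o ≤ n → n ≤ suc m → o ≡ m ⊎ o ≡ n
m≤o≤n≤1+m⇒o≡m⊎o≡n {m} {n} {o} m≤o o≤n n≤1+m with o ≤? m
... | yes o≤m = inj₁ (≤-antisym o≤m m≤o)
... | no  o≰m = inj₂ (≤-antisym o≤n (≤-trans n≤1+m (≰⇒> o≰m)))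

∣n⇒∣m*[1+n]⇒∣m : ∀ {d m n} → d ∣ n → d ∣ m * suc n → d ∣ m
∣n⇒∣m*[1+n]⇒∣m {d} {m} {n} d∣n d∣m*[1+n] =
  ∣m+n∣m⇒∣n (subst (d ∣_) (trans (*-suc m n) (+-comm m (m * n))) d∣m*[1+n]) (∣n⇒∣m*n m d∣n)

m≤n/o⇔m*o≤n : ∀ m n o .{{_ : NonZero o}} → m ≤ n / o ⇔ m * o ≤ n
m≤n/o⇔m*o≤n m n o = mk⇔
  (λ m≤n/o → ≤-trans (*-monoˡ-≤ o m≤n/o) (m/n*n≤m n o))
  (λ m*o≤n → subst (_≤ n / o) (m*n/n≡m m o) (/-monoˡ-≤ o m*o≤n))

m/n<o⇔m<o*n : ∀ m n o .{{_ : NonZero n}} → m / n < o ⇔ m < o * n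
m/n<o⇔m<o*n m n o = mk⇔
  (λ m/n<o → ≰⇒> (λ o*n≤m → <⇒≱ m/n<o (from (m≤n/o⇔m*o≤n o m n) o*n≤m)))
  m<n*o⇒m/o<n

⌈m/1+n⌉≡[m+n]/1+n : ∀ m n → ⌈ m / suc n ⌉ ≡ (m + n) / suc n
⌈m/1+n⌉≡[m+n]/1+n m n = cong (_/ suc n) (+-∸-assoc m (s≤s z≤n))

⌈m/n⌉≤o⇔m≤o*n : ∀ m n o .{{_ : NonZero n}} → ⌈ m / n ⌉ ≤ o ⇔ m ≤ o * n
⌈m/n⌉≤o⇔m≤o*n m (suc n) o rewrite ⌈m/1+n⌉≡[m+n]/1+n m n = mk⇔
  (λ ⌈m/n⌉≤o → +-cancelˡ-≤ n m (o * suc n) (subst (_≤ n + o * suc n) (+-comm m n)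
                 (s≤s⁻¹ (to (m/n<o⇔m<o*n (m + n) (suc n) (suc o)) (s≤s ⌈m/n⌉≤o)))))
  (λ m≤o*n → s≤s⁻¹ (from (m/n<o⇔m<o*n (m + n) (suc n) (suc o))
                 (s≤s (subst (_≤ n + o * suc n) (+-comm n m) (+-monoʳ-≤ n m≤o*n)))))

o<⌈m/n⌉⇔o*n<m : ∀ m n o .{{_ : NonZero n}} → o < ⌈ m / n ⌉ ⇔ o * n < m
o<⌈m/n⌉⇔o*n<m m n o = mk⇔
  (λ o<⌈m/n⌉ → ≰⇒> (λ m≤o*n → <⇒≱ o<⌈m/n⌉ (from (⌈m/n⌉≤o⇔m≤o*n m n o) m≤o*n)))
  (λ o*n<m → ≰⇒> (λ ⌈m/n⌉≤o → <⇒≱ o*n<m (to (⌈m/n⌉≤o⇔m≤o*n m n o) ⌈m/n⌉≤o)))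

m≤⌈m/n⌉*n : ∀ m n .{{_ : NonZero n}} → m ≤ ⌈ m / n ⌉ * n
m≤⌈m/n⌉*n m n = to (⌈m/n⌉≤o⇔m≤o*n m n _) ≤-refl

m<⌈m/n⌉*n : ∀ m n .{{_ : NonZero n}} → ¬ n ∣ m → m < ⌈ m / n ⌉ * n
m<⌈m/n⌉*n m n n∤m = ≤∧≢⇒< (m≤⌈m/n⌉*n m n) (λ m≡ → n∤m (divides ⌈ m / n ⌉ m≡))

⌈/⌉-monoˡ-≤ : ∀ {m n} o .{{_ : NonZero o}} → m ≤ n → ⌈ m / o ⌉ ≤ ⌈ n / o ⌉
⌈/⌉-monoˡ-≤ {m} {n} o m≤n = from (⌈m/n⌉≤o⇔m≤o*n m o _) (≤-trans m≤n (m≤⌈m/n⌉*n n o))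

⌈0/n⌉≡0 : ∀ n .{{_ : NonZero n}} → ⌈ 0 / n ⌉ ≡ 0
⌈0/n⌉≡0 n = n≤0⇒n≡0 (from (⌈m/n⌉≤o⇔m≤o*n 0 n 0) z≤n)

m/n≤⌈m/n⌉ : ∀ m n .{{_ : NonZero n}} → m / n ≤ ⌈ m / n ⌉
m/n≤⌈m/n⌉ m (suc n) =
  subst (m / suc n ≤_) (sym (⌈m/1+n⌉≡[m+n]/1+n m n)) (/-monoˡ-≤ (suc n) (m≤m+n m n))

⌈m/n⌉≤1+m/n : ∀ m n .{{_ : NonZero n}} → ⌈ m / n ⌉ ≤ suc (m / n)
⌈m/n⌉≤1+m/n m n = from (⌈m/n⌉≤o⇔m≤o*n m n _) (begin
  m                  ≡⟨ m≡m%n+[m/n]*n m n ⟩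
  m % n + m / n * n  ≤⟨ +-monoˡ-≤ (m / n * n) (<⇒≤ (m%n<n m n)) ⟩
  n + m / n * n      ∎)
  where open ≤-Reasoning

⌈1+m/n⌉≡1+m/n : ∀ m n .{{_ : NonZero n}} → ⌈ suc m / n ⌉ ≡ suc (m / n)
⌈1+m/n⌉≡1+m/n m (suc n) = begin
  ⌈ suc m / suc n ⌉          ≡⟨ ⌈m/1+n⌉≡[m+n]/1+n (suc m) n ⟩
  suc (m + n) / suc n        ≡⟨ cong (_/ suc n) (+-suc m n) ⟨
  (m + suc n) / suc n        ≡⟨ +-distrib-/-∣ʳ m ∣-refl ⟩
  m / suc n + suc n / suc n  ≡⟨ cong (m / suc n +_) (n/n≡1 (suc n)) ⟩
  m / suc n + 1              ≡⟨ +-comm (m / suc n) 1 ⟩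
  suc (m / suc n)            ∎
  where open ≡-Reasoning

⌈[m*n+o]/n⌉≡m+⌈o/n⌉ : ∀ m n o .{{_ : NonZero n}} → ⌈ (m * n + o) / n ⌉ ≡ m + ⌈ o / n ⌉
⌈[m*n+o]/n⌉≡m+⌈o/n⌉ m (suc n) o = begin
  ⌈ (m * suc n + o) / suc n ⌉              ≡⟨ ⌈m/1+n⌉≡[m+n]/1+n (m * suc n + o) n ⟩
  (m * suc n + o + n) / suc n              ≡⟨ cong (_/ suc n) (+-assoc (m * suc n) o n) ⟩
  (m * suc n + (o + n)) / suc n            ≡⟨ +-distrib-/-∣ˡ (o + n) (n∣m*n m) ⟩
  m * suc n / suc n + (o + n) / suc n      ≡⟨ cong₂ _+_ (m*n/n≡m m (suc n)) (sym (⌈m/1+n⌉≡[m+n]/1+n o n)) ⟩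
  m + ⌈ o / suc n ⌉                        ∎
  where open ≡-Reasoning

m/o+⌈n/o⌉≤⌈[m+n]/o⌉ : ∀ m n o .{{_ : NonZero o}} → m / o + ⌈ n / o ⌉ ≤ ⌈ (m + n) / o ⌉
m/o+⌈n/o⌉≤⌈[m+n]/o⌉ m n o = begin
  m / o + ⌈ n / o ⌉        ≡⟨ ⌈[m*n+o]/n⌉≡m+⌈o/n⌉ (m / o) o n ⟨
  ⌈ (m / o * o + n) / o ⌉  ≤⟨ ⌈/⌉-monoˡ-≤ o (+-monoˡ-≤ n (m/n*n≤m m o)) ⟩
  ⌈ (m + n) / o ⌉          ∎
  where open ≤-Reasoning

⌈[m+n]/o⌉≤⌈m/o⌉+⌈n/o⌉ : ∀ m n o .{{_ : NonZero o}} → ⌈ (m + n) / o ⌉ ≤ ⌈ m / o ⌉ + ⌈ n / o ⌉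
⌈[m+n]/o⌉≤⌈m/o⌉+⌈n/o⌉ m n o = from (⌈m/n⌉≤o⇔m≤o*n (m + n) o _) (begin
  m + n                          ≤⟨ +-mono-≤ (m≤⌈m/n⌉*n m o) (m≤⌈m/n⌉*n n o) ⟩
  ⌈ m / o ⌉ * o + ⌈ n / o ⌉ * o  ≡⟨ *-distribʳ-+ o ⌈ m / o ⌉ ⌈ n / o ⌉ ⟨
  (⌈ m / o ⌉ + ⌈ n / o ⌉) * o    ∎)
  where open ≤-Reasoning

⌈[1+m+n]/o⌉≤⌈m/o⌉+⌈n/o⌉ : ∀ m n o .{{_ : NonZero o}} → (o ∣ m → o ∣ n → ⊥) →
  ⌈ suc (m + n) / o ⌉ ≤ ⌈ m / o ⌉ + ⌈ n / o ⌉
⌈[1+m+n]/o⌉≤⌈m/o⌉+⌈n/o⌉ m n o ¬both = from (⌈m/n⌉≤o⇔m≤o*n (suc (m + n)) o _) (begin-strict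
  m + n                          <⟨ m+n<⌈m/o⌉*o+⌈n/o⌉*o ⟩
  ⌈ m / o ⌉ * o + ⌈ n / o ⌉ * o  ≡⟨ *-distribʳ-+ o ⌈ m / o ⌉ ⌈ n / o ⌉ ⟨
  (⌈ m / o ⌉ + ⌈ n / o ⌉) * o    ∎)
  where
  open ≤-Reasoning
  m+n<⌈m/o⌉*o+⌈n/o⌉*o : m + n < ⌈ m / o ⌉ * o + ⌈ n / o ⌉ * o
  m+n<⌈m/o⌉*o+⌈n/o⌉*o with o ∣? m
  ... | no  o∤m = +-mono-<-≤ (m<⌈m/n⌉*n m o o∤m) (m≤⌈m/n⌉*n n o)
  ... | yes o∣m = +-mono-≤-< (m≤⌈m/n⌉*n m o) (m<⌈m/n⌉*n n o (¬both o∣m))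

module _ {p} {P : Pred ℕ p} (P? : Decidable P) {a c : ℕ} (P⇔ : ∀ v → P v ⇔ (a ≤ v × v < c)) where

  private
    inside-step : ∀ {n} → a ≤ n → n < c → n ⊓ c ∸ n ⊓ a + 1 ≡ suc n ⊓ c ∸ suc n ⊓ a
    inside-step {n} a≤n n<c
      rewrite m≤n⇒m⊓n≡m (<⇒≤ n<c) | m≤n⇒m⊓n≡m n<c | m≥n⇒m⊓n≡n a≤n | m≥n⇒m⊓n≡n (m≤n⇒m≤1+n a≤n)
      = trans (+-comm (n ∸ a) 1) (sym (+-∸-assoc 1 a≤n))

    outside-step : ∀ {n} → ¬ (a ≤ n × n < c) → n ⊓ c ∸ n ⊓ a ≡ suc n ⊓ c ∸ suc n ⊓ a
    outside-step {n} ∉ with n <? a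
    ... | yes n<a
      rewrite m≤n⇒m⊓n≡m (<⇒≤ n<a) | m≤n⇒m⊓n≡m n<a
            | m≤n⇒m∸n≡0 (m⊓n≤m n c) | m≤n⇒m∸n≡0 (m⊓n≤m (suc n) c) = refl
    ... | no n≮a with n <? c
    ...   | yes n<c = ⊥-elim (∉ (≮⇒≥ n≮a , n<c))
    ...   | no n≮c
      rewrite m≥n⇒m⊓n≡n (≮⇒≥ n≮a) | m≥n⇒m⊓n≡n (m≤n⇒m≤1+n (≮⇒≥ n≮a))
            | m≥n⇒m⊓n≡n (≮⇒≥ n≮c) | m≥n⇒m⊓n≡n (m≤n⇒m≤1+n (≮⇒≥ n≮c)) = refl

  length-filter-upTo : ∀ n → length (filter P? (upTo n)) ≡ n ⊓ c ∸ n ⊓ a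
  length-filter-upTo zero = refl
  length-filter-upTo (suc n) = begin
    length (filter P? (upTo (suc n)))                      ≡⟨ cong (length ∘ filter P?) (upTo-∷ʳ n) ⟨
    length (filter P? (upTo n ∷ʳ n))                       ≡⟨ cong length (filter-++ P? (upTo n) (n ∷ [])) ⟩
    length (filter P? (upTo n) ++ filter P? (n ∷ []))      ≡⟨ length-++ (filter P? (upTo n)) ⟩
    length (filter P? (upTo n)) + length (filter P? (n ∷ [])) ≡⟨ cong (_+ length (filter P? (n ∷ []))) (length-filter-upTo n) ⟩
    n ⊓ c ∸ n ⊓ a + length (filter P? (n ∷ []))            ≡⟨ last-step ⟩
    suc n ⊓ c ∸ suc n ⊓ a                                  ∎
    where
    open ≡-Reasoning
    last-step : n ⊓ c ∸ n ⊓ a + length (filter P? (n ∷ [])) ≡ suc n ⊓ c ∸ suc n ⊓ a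
    last-step with P? n
    ... | yes Pn = let (a≤n , n<c) = to (P⇔ n) Pn in inside-step a≤n n<c
    ... | no ¬Pn = trans (+-identityʳ _) (outside-step (¬Pn ∘ from (P⇔ n)))

  length-filter-upTo-interval : ∀ {n} → a ≤ c → c ≤ n → length (filter P? (upTo n)) ≡ c ∸ a
  length-filter-upTo-interval {n} a≤c c≤n
    rewrite length-filter-upTo n | m≥n⇒m⊓n≡n c≤n | m≥n⇒m⊓n≡n (≤-trans a≤c c≤n) = refl

preimageCount-∷-≡ : ∀ μ x xs {t} → μ x ≡ t → preimageCount μ (x ∷ xs) t ≡ suc (preimageCount μ xs t)
preimageCount-∷-≡ μ x xs μx≡t = cong length (filter-accept (λ v → μ v ≟ _) {xs = xs} μx≡t)

preimageCount-∷-≢ : ∀ μ x xs {t} → μ x ≢ t → preimageCount μ (x ∷ xs) t ≡ preimageCount μ xs t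
preimageCount-∷-≢ μ x xs μx≢t = cong length (filter-reject (λ v → μ v ≟ _) {xs = xs} μx≢t)

preimageCount-map : ∀ μ h xs t → preimageCount μ (map h xs) t ≡ preimageCount (μ ∘ h) xs t
preimageCount-map μ h [] t = refl
preimageCount-map μ h (x ∷ xs) t with μ (h x) ≟ t
... | yes μhx≡t = begin
  preimageCount μ (h x ∷ map h xs) t  ≡⟨ preimageCount-∷-≡ μ (h x) (map h xs) μhx≡t ⟩
  suc (preimageCount μ (map h xs) t)  ≡⟨ cong suc (preimageCount-map μ h xs t) ⟩
  suc (preimageCount (μ ∘ h) xs t)    ≡⟨ preimageCount-∷-≡ (μ ∘ h) x xs μhx≡t ⟨
  preimageCount (μ ∘ h) (x ∷ xs) t    ∎
  where open ≡-Reasoning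
... | no μhx≢t = begin
  preimageCount μ (h x ∷ map h xs) t  ≡⟨ preimageCount-∷-≢ μ (h x) (map h xs) μhx≢t ⟩
  preimageCount μ (map h xs) t        ≡⟨ preimageCount-map μ h xs t ⟩
  preimageCount (μ ∘ h) xs t          ≡⟨ preimageCount-∷-≢ (μ ∘ h) x xs μhx≢t ⟨
  preimageCount (μ ∘ h) (x ∷ xs) t    ∎
  where open ≡-Reasoning

mostUniform : ∀ {Q r q μ} .{{_ : NonZero r}} → length Q ≡ q → Unique Q → (∀ v → v ∈ Q → μ v < r) →
  (∀ t → t < r → q / r ≤ preimageCount μ Q t × preimageCount μ Q t ≤ ⌈ q / r ⌉) →
  MostUniform Q r μ
mostUniform {r = r} {q} refl unique bounded counts = unique , bounded , λ t t<r →
  let (lower , upper) = counts t t<r in m≤o≤n≤1+m⇒o≡m⊎o≡n lower upper (⌈m/n⌉≤1+m/n q r)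

mostUniform-map⁻ : ∀ {Q r μ} .{{_ : NonZero r}} h → MostUniform (map h Q) r μ → MostUniform Q r (μ ∘ h)
mostUniform-map⁻ {Q} {r} {μ} h (unique , bounded , counts) =
  map⁻ unique , (λ v v∈Q → bounded (h v) (∈-map⁺ h v∈Q)) , counts′
  where
  counts′ : ∀ t → t < r → (preimageCount (μ ∘ h) Q t ≡ length Q / r)
                          ⊎ (preimageCount (μ ∘ h) Q t ≡ ⌈ length Q / r ⌉)
  counts′ t t<r rewrite sym (preimageCount-map μ h Q t) | sym (length-map h Q) = counts t t<r

module Scaling (r M : ℕ) .{{_ : NonZero r}} where

  N : ℕ
  N = suc M

  scale : ℕ → ℕ
  scale v = v * r / N

  cut : ℕ → ℕ
  cut t = ⌈ t * N / r ⌉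

  scale≡⇔cut≤×<cut : ∀ v t → scale v ≡ t ⇔ (cut t ≤ v × v < cut (suc t))
  scale≡⇔cut≤×<cut v t = begin
    scale v ≡ t                          ≈⟨ m≡n⇔n≤m<1+n ⟩
    (t ≤ scale v × scale v < suc t)      ≈⟨ m≤n/o⇔m*o≤n t (v * r) N ×-⇔ m/n<o⇔m<o*n (v * r) N (suc t) ⟩
    (t * N ≤ v * r × v * r < suc t * N)  ≈⟨ ⌈m/n⌉≤o⇔m≤o*n (t * N) r v ×-⇔ o<⌈m/n⌉⇔o*n<m (suc t * N) r v ⟨
    (cut t ≤ v × v < cut (suc t))        ∎
    where open SetoidReasoning (⇔-setoid 0ℓ)

  scale<r : ∀ {v} → v < N → scale v < r
  scale<r {v} v<N = m<n*o⇒m/o<n (subst (v * r <_) (*-comm N r) (*-monoˡ-< r v<N))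

  scale0≡0 : scale 0 ≡ 0
  scale0≡0 = 0/n≡0 N

  preimageCount-upTo : ∀ t → t < r → preimageCount scale [ N ] t ≡ cut (suc t) ∸ cut t
  preimageCount-upTo t t<r = length-filter-upTo-interval (λ v → scale v ≟ t) (λ v → scale≡⇔cut≤×<cut v t)
    (⌈/⌉-monoˡ-≤ r (m≤n+m (t * N) N))
    (from (⌈m/n⌉≤o⇔m≤o*n (suc t * N) r N) (subst (suc t * N ≤_) (*-comm r N) (*-monoˡ-≤ N t<r)))

  cut-gap-bounds : ∀ t → N / r ≤ cut (suc t) ∸ cut t × cut (suc t) ∸ cut t ≤ ⌈ N / r ⌉
  cut-gap-bounds t =
    m+n≤o⇒m≤o∸n (N / r) (m/o+⌈n/o⌉≤⌈[m+n]/o⌉ N (t * N) r) ,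
    m≤n+o⇒m∸n≤o (cut (suc t)) (cut t) (subst (cut (suc t) ≤_) (+-comm ⌈ N / r ⌉ (cut t))
      (⌈[m+n]/o⌉≤⌈m/o⌉+⌈n/o⌉ N (t * N) r))

  cut-gap-bounds-pred : ∀ t → suc t < r → M / r ≤ cut (2 + t) ∸ cut (suc t) × cut (2 + t) ∸ cut (suc t) ≤ ⌈ M / r ⌉
  cut-gap-bounds-pred t 1+t<r =
    ≤-trans (/-monoˡ-≤ r (n≤1+n M)) (proj₁ (cut-gap-bounds (suc t))) ,
    m≤n+o⇒m∸n≤o (cut (2 + t)) (cut (suc t)) (subst (cut (2 + t) ≤_) (+-comm ⌈ M / r ⌉ (cut (suc t)))
      (⌈[1+m+n]/o⌉≤⌈m/o⌉+⌈n/o⌉ M (suc t * N) r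
        (λ r∣M r∣[1+t]*N → <⇒≱ 1+t<r (∣⇒≤ (∣n⇒∣m*[1+n]⇒∣m r∣M r∣[1+t]*N)))))

  mostUniform-upTo : MostUniform [ N ] r scale
  mostUniform-upTo = mostUniform (length-upTo N) (upTo⁺ N) (λ _ v∈ → scale<r (∈-upTo⁻ v∈)) counts
    where
    counts : ∀ t → t < r → N / r ≤ preimageCount scale [ N ] t × preimageCount scale [ N ] t ≤ ⌈ N / r ⌉
    counts t t<r rewrite preimageCount-upTo t t<r = cut-gap-bounds t

  upTo≡0∷range1 : [ N ] ≡ 0 ∷ range1 N
  upTo≡0∷range1 = cong (0 ∷_) (sym (map-upTo suc M))

  preimageCount-0∷range1 : ∀ t → preimageCount scale (0 ∷ range1 N) t ≡ preimageCount scale [ N ] t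
  preimageCount-0∷range1 t = cong (λ Q → preimageCount scale Q t) (sym upTo≡0∷range1)

  preimageCount-range1-0 : preimageCount scale (range1 N) 0 ≡ M / r
  preimageCount-range1-0 = suc-injective (begin
    suc (preimageCount scale (range1 N) 0)  ≡⟨ preimageCount-∷-≡ scale 0 (range1 N) scale0≡0 ⟨
    preimageCount scale (0 ∷ range1 N) 0    ≡⟨ preimageCount-0∷range1 0 ⟩
    preimageCount scale [ N ] 0             ≡⟨ preimageCount-upTo 0 (>-nonZero⁻¹ r) ⟩
    cut 1 ∸ cut 0                           ≡⟨ cong₂ _∸_ (cong (λ x → ⌈ x / r ⌉) (+-identityʳ N)) (⌈0/n⌉≡0 r) ⟩
    ⌈ N / r ⌉                               ≡⟨ ⌈1+m/n⌉≡1+m/n M r ⟩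
    suc (M / r)                             ∎)
    where open ≡-Reasoning

  preimageCount-range1-suc : ∀ t → preimageCount scale (range1 N) (suc t) ≡ preimageCount scale [ N ] (suc t)
  preimageCount-range1-suc t = trans
    (sym (preimageCount-∷-≢ scale 0 (range1 N) (λ scale0≡1+t → 0≢1+n (trans (sym scale0≡0) scale0≡1+t))))
    (preimageCount-0∷range1 (suc t))

  mostUniform-range1 : MostUniform (range1 N) r scale
  mostUniform-range1 =
    mostUniform (trans (length-map suc (upTo M)) (length-upTo M)) (map⁺ suc-injective (upTo⁺ M))
      (λ v v∈ → scale<r (∈-upTo⁻ (subst (v ∈_) (sym upTo≡0∷range1) (there v∈)))) counts
    where
    counts : ∀ t → t < r → M / r ≤ preimageCount scale (range1 N) t × preimageCount scale (range1 N) t ≤ ⌈ M / r ⌉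
    counts zero _ rewrite preimageCount-range1-0 = ≤-refl , m/n≤⌈m/n⌉ M r
    counts (suc t) 1+t<r rewrite preimageCount-range1-suc t | preimageCount-upTo (suc t) 1+t<r =
      cut-gap-bounds-pred t 1+t<r

mostUniform-upTo : ∀ r N .{{_ : NonZero r}} .{{_ : NonZero N}} → MostUniform [ N ] r (λ v → v * r / N)
mostUniform-upTo r (suc M) = Scaling.mostUniform-upTo r M

mostUniform-range1 : ∀ r N .{{_ : NonZero r}} .{{_ : NonZero N}} → MostUniform (range1 N) r (λ v → v * r / N)
mostUniform-range1 r (suc M) = Scaling.mostUniform-range1 r M

lemma3 : (r b : ℕ) → .{{_ : NonZero r}} → .{{_ : NonZero b}} →
    MostUniform [ 2 ^ b ] r (λ v → (v * r) /2^ b)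
    × MostUniform (range1 (2 ^ b)) r (λ v → (v * r) /2^ b)
    × MostUniform [ 2 ^ b ∸ 1 ] r (λ v → (suc v * r) /2^ b)
lemma3 r b =
  mostUniform-upTo r (2 ^ b) ,
  mostUniform-range1 r (2 ^ b) ,
  mostUniform-map⁻ suc (mostUniform-range1 r (2 ^ b))
  where
  instance
    2^b≢0 : NonZero (2 ^ b)
    2^b≢0 = m^n≢0 2 b
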